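{- Let $\Gamma$ be a directed graph with vertex set contained in $\{1,\dots,n\}$ and directed edge set $E(\Gamma)$, and let $D$ be a cone in $\mathbb{R}^n$ whose edge vectors are $\{e_b-e_a : (a,b)\in E(\Gamma)\}$. The following are equivalent: (1) $D$ is simplicial; (2) $\Gamma$ is a forest as an undirected graph; (3) $D$ is non-singular, i.e. the set $\{e_b-e_a : (a,b)\in E(\Gamma)\}$ is part of a $\mathbb{Z}$-basis of $H^{n-1}\cap\mathbb{Z}^n$. In particular, for every $w\in\mathfrak{S}_n$, the cone $D_w$ is simplicial if and only if it is non-singular.
   Context: $e_1,\dots,e_n$ is the standard basis of $\mathbb{R}^n$ and $H^{n-1}=\{x\in\mathbb{R}^n : x_1+\cdots+x_n=0\}$. An edge vector of a cone is a vector spanning one of its one-dimensional faces. For $w\in\mathfrak{S}_n$ (one-line notation, $\ell$ length, $t_{a,b}$ the transposition of $a,b$): $E(w)=\{(w(i),w(j)) : 1\le i<j\le n,\ \ell(w)-\ell(t_{w(i),w(j)}w)=1\}$ and $D_w$ is the cone spanned by $\{e_b-e_a : (a,b)\in E(w)\}$; each such $e_b-e_a$ is an edge vector of $D_w$. -}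

module Defs where

open import Data.Nat as ℕ using (ℕ; zero; suc)
open import Data.Bool using (Bool; true; false; if_then_else_; _∧_)
open import Data.Fin using (Fin; zero; suc; _≟_; _<?_; toℕ; fromℕ<)
open import Data.Fin.Permutation using (Permutation′; _⟨$⟩ʳ_; _⟨$⟩ˡ_; transpose)
open import Data.Integer as ℤ using (ℤ)
open import Data.Rational as ℚ using (ℚ; 0ℚ; 1ℚ)
open import Data.Product using (Σ; ∃; _×_; _,_; proj₁; proj₂)
open import Relation.Binary.PropositionalEquality using (_≡_; _≢_)
open import Relation.Nullary using (¬_; yes; no)
open import Relation.Nullary.Decidable using (⌊_⌋)

sumℚ : ∀ {k} → (Fin k → ℚ) → ℚ
sumℚ {zero}  f = 0ℚ
sumℚ {suc k} f = f zero ℚ.+ sumℚ (λ i → f (suc i))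

sumℤ : ∀ {k} → (Fin k → ℤ) → ℤ
sumℤ {zero}  f = ℤ.0ℤ
sumℤ {suc k} f = f zero ℤ.+ sumℤ (λ i → f (suc i))

sumℕ : ∀ {k} → (Fin k → ℕ) → ℕ
sumℕ {zero}  f = 0
sumℕ {suc k} f = f zero ℕ.+ sumℕ (λ i → f (suc i))

-- Directed graphs on vertex set {1,…,n} (here Fin n): the edge set
-- E(Γ) ⊆ [n] × [n] is given by its (decidable) indicator.

DiGraph : ℕ → Set
DiGraph n = Fin n → Fin n → Bool

δℚ : ∀ {n} → Fin n → Fin n → ℚ
δℚ a k = if ⌊ a ≟ k ⌋ then 1ℚ else 0ℚ

δℤ : ∀ {n} → Fin n → Fin n → ℤ
δℤ a k = if ⌊ a ≟ k ⌋ then ℤ.1ℤ else ℤ.0ℤ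

edgeVecℚ : ∀ {n} → Fin n → Fin n → (Fin n → ℚ)
edgeVecℚ a b k = δℚ b k ℚ.- δℚ a k

edgeVecℤ : ∀ {n} → Fin n → Fin n → (Fin n → ℤ)
edgeVecℤ a b k = δℤ b k ℤ.- δℤ a k

combℚ : ∀ {n} → DiGraph n → (Fin n → Fin n → ℚ) → Fin n → ℚ
combℚ E c k = sumℚ λ a → sumℚ λ b →
  if E a b then c a b ℚ.* edgeVecℚ a b k else 0ℚ

combℤ : ∀ {n} → DiGraph n → (Fin n → Fin n → ℤ) → Fin n → ℤ
combℤ E c k = sumℤ λ a → sumℤ λ b →
  if E a b then c a b ℤ.* edgeVecℤ a b k else ℤ.0ℤ

InCone : ∀ {n} → DiGraph n → (Fin n → ℚ) → Set
InCone {n} E x = Σ (Fin n → Fin n → ℚ) λ c →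
    (∀ a b → 0ℚ ℚ.≤ c a b) × (∀ k → x k ≡ combℚ E c k)

-- v spans a one-dimensional face (extreme ray) of the cone D:
-- v ∈ D, v ≠ 0, and whenever v = x + y with x, y ∈ D, x is a
-- nonnegative multiple of v.
IsEdgeVector : ∀ {n} → DiGraph n → (Fin n → ℚ) → Set
IsEdgeVector {n} E v =
  InCone E v ×
  ¬ (∀ k → v k ≡ 0ℚ) ×
  (∀ x y → InCone E x → InCone E y → (∀ k → x k ℚ.+ y k ≡ v k) →
     Σ ℚ λ t → (0ℚ ℚ.≤ t) × (∀ k → x k ≡ t ℚ.* v k))

-- Hypothesis of the lemma: every e_b - e_a, (a,b) ∈ E(Γ), is an edge
-- vector of D (and D is spanned by them, so these are all its edge vectors).
EdgeVectorsAre : ∀ {n} → DiGraph n → Set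
EdgeVectorsAre E = ∀ a b → E a b ≡ true → IsEdgeVector E (edgeVecℚ a b)

-- D is simplicial: its edge vectors are linearly independent.
Simplicial : ∀ {n} → DiGraph n → Set
Simplicial E = ∀ c → (∀ k → combℚ E c k ≡ 0ℚ) →
  ∀ a b → E a b ≡ true → c a b ≡ 0ℚ

-- D is non-singular: {e_b - e_a : (a,b) ∈ E} is part of a ℤ-basis of
-- H^{n-1} ∩ ℤ^n, i.e. there are u₁,…,u_k ∈ H^{n-1} ∩ ℤ^n such that the
-- edge vectors together with the u_j form a ℤ-basis of H^{n-1} ∩ ℤ^n.
InH : ∀ {n} → (Fin n → ℤ) → Set
InH x = sumℤ x ≡ ℤ.0ℤ

NonSingular : ∀ {n} → DiGraph n → Set
NonSingular {n} E =
  Σ ℕ λ k → Σ (Fin k → Fin n → ℤ) λ u →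
    (∀ j → InH (u j)) ×
    (∀ (c : Fin n → Fin n → ℤ) (d : Fin k → ℤ) → (∀ t → combℤ E c t ℤ.+ sumℤ (λ j → d j ℤ.* u j t) ≡ ℤ.0ℤ) →
       (∀ a b → E a b ≡ true → c a b ≡ ℤ.0ℤ) × (∀ j → d j ≡ ℤ.0ℤ)) ×
    (∀ x → InH x → Σ (Fin n → Fin n → ℤ) λ c → Σ (Fin k → ℤ) λ d →
       ∀ t → x t ≡ combℤ E c t ℤ.+ sumℤ (λ j → d j ℤ.* u j t))

-- A cycle of length k ≥ 1: pairwise distinct vertices v₀,…,v_{k-1} and,
-- for each j, an edge of Γ joining v_j and v_{j+1 mod k} (in one of the two
-- directions, chosen by dir j), the k edges used being pairwise distinct.

next : ∀ {k} → Fin (suc k) → Fin (suc k)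
next {k} j with toℕ j ℕ.<? k
... | yes p = fromℕ< (ℕ.s≤s p)
... | no _  = zero

stepEdge : ∀ {n k} → (Fin (suc k) → Fin n) → (Fin (suc k) → Bool) →
           Fin (suc k) → Fin n × Fin n
stepEdge v dir j = if dir j then (v j , v (next j)) else (v (next j) , v j)

HasCycle : ∀ {n} → DiGraph n → Set
HasCycle {n} E =
  Σ ℕ λ k → Σ (Fin (suc k) → Fin n) λ v → Σ (Fin (suc k) → Bool) λ dir →
    (∀ i j → v i ≡ v j → i ≡ j) ×
    (∀ i j → stepEdge v dir i ≡ stepEdge v dir j → i ≡ j) ×
    (∀ j → E (proj₁ (stepEdge v dir j)) (proj₂ (stepEdge v dir j)) ≡ true)

IsForest : ∀ {n} → DiGraph n → Set
IsForest E = ¬ HasCycle E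

invCount : ∀ {n} → (Fin n → Fin n) → ℕ
invCount w = sumℕ λ i → sumℕ λ j →
  if ⌊ i <? j ⌋ ∧ ⌊ w j <? w i ⌋ then 1 else 0

len : ∀ {n} → Permutation′ n → ℕ
len w = invCount (w ⟨$⟩ʳ_)

lenTw : ∀ {n} → Fin n → Fin n → Permutation′ n → ℕ
lenTw a b w = invCount (λ i → transpose a b ⟨$⟩ʳ (w ⟨$⟩ʳ i))

-- (a,b) ∈ E(w)  iff  a = w(i), b = w(j) with i < j and ℓ(w) - ℓ(t_{a,b} w) = 1
Ew : ∀ {n} → Permutation′ n → DiGraph n
Ew w a b = ⌊ (w ⟨$⟩ˡ a) <? (w ⟨$⟩ˡ b) ⌋ ∧ ⌊ len w ℕ.≟ suc (lenTw a b w) ⌋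

-- A cycle v₀, …, v_k of Γ gives the relation Σⱼ ±(e_{v_{j+1}} − e_{v_j}) = 0 among the vectors e_b − e_a,
-- so if these are linearly independent, over ℚ or over ℤ, then Γ is a forest. Conversely, removing leaves one
-- at a time hangs a forest from its roots: every edge gets an upper and a lower endpoint, and distinct edges
-- have distinct lower endpoints. Evaluating a relation at the lower endpoints, in order of increasing height,
-- kills its coefficients one by one. Over ℤ the vectors e_x − e_r, for the roots x ≠ r with r of maximal
-- height, complete the edge vectors to a basis of H ∩ ℤⁿ: a vector y with coordinate sum 0 is the combination
-- in which the edge with lower endpoint x, or the vector e_x − e_r if x is a root, gets as coefficient the sum
-- of y over the subtree hanging from x.

module Submission where

open import Defs
open import Data.Nat using (ℕ)
open import Data.Product using (_×_)
open import Data.Fin.Permutation using (Permutation′)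
open import Function.Bundles using (_⇔_)

open import Level using (0ℓ)
open import Algebra.Bundles using (CommutativeRing)
open import Data.Bool using (Bool; true; false; if_then_else_; _∧_; not)
import Data.Bool.Properties as Bool
open import Data.Bool.Properties using (if-cong)
open import Data.Empty using (⊥-elim)
open import Data.Fin as Fin using (Fin; zero; suc; toℕ; fromℕ<; inject₁; fromℕ; _≟_)
import Data.Fin.Properties as Fin
open import Data.Integer as ℤ using (ℤ)
import Data.Integer.Properties as ℤ
open import Data.List using (List; filter; allFin; lookup; length)
open import Data.List.Extrema.Nat using (argmax; f[xs]≤f[argmax])
open import Data.List.Membership.Propositional.Properties using (∈-filter⁺; ∈-filter⁻; ∈-allFin; ∈-lookup)
import Data.List.Relation.Unary.All as All
open import Data.List.Relation.Unary.AllPairs using (_∷_)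
open import Data.List.Relation.Unary.Any using (index)
open import Data.List.Relation.Unary.Any.Properties using (lookup-index)
open import Data.List.Relation.Unary.Unique.Propositional using (Unique)
import Data.List.Relation.Unary.Unique.Propositional.Properties as Unique
open import Data.Nat as ℕ using (zero; suc; z≤n; s≤s; _<_; _≤_)
open import Data.Nat.Induction using (<-rec)
import Data.Nat.Properties as ℕ
open import Data.Product using (Σ; ∃; ∃₂; _,_; proj₁; proj₂)
import Data.Product.Properties as Product
open import Data.Rational as ℚ using (ℚ; 0ℚ)
import Data.Rational.Properties as ℚ
open import Data.Sum using (_⊎_; inj₁; inj₂)
open import Function using (_∘_; mk⇔)
open import Relation.Binary.Definitions using (DecidableEquality; tri<; tri≈; tri>)
open import Relation.Binary.PropositionalEquality
open import Relation.Nullary using (¬_; Dec; yes; no; _×-dec_; _⊎-dec_; ¬?)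
open import Relation.Nullary.Decidable using (⌊_⌋)
open import Relation.Unary using (Pred; Decidable)

record Enumeration {n} (P : Pred (Fin n) 0ℓ) : Set where
  field
    size : ℕ
    element : Fin size → Fin n
    element-injective : ∀ {i j} → element i ≡ element j → i ≡ j
    element-satisfies : ∀ j → P (element j)
    element-onto : ∀ {x} → P x → ∃ λ j → element j ≡ x

lookup-injective : ∀ {A : Set} {xs : List A} → Unique xs → ∀ {i j} → lookup xs i ≡ lookup xs j → i ≡ j
lookup-injective (_ ∷ _) {zero} {zero} _ = refl
lookup-injective (x∉ ∷ _) {zero} {suc j} e = ⊥-elim (All.lookup x∉ (∈-lookup j) e)
lookup-injective (x∉ ∷ _) {suc i} {zero} e = ⊥-elim (All.lookup x∉ (∈-lookup i) (sym e))
lookup-injective (_ ∷ u) {suc i} {suc j} e = cong suc (lookup-injective u e)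

enumerate : ∀ {n} {P : Pred (Fin n) 0ℓ} → Decidable P → Enumeration P
enumerate {n} {P} P? = record
  { size = length xs
  ; element = lookup xs
  ; element-injective = lookup-injective (Unique.filter⁺ P? (Unique.allFin⁺ n))
  ; element-satisfies = λ j → proj₂ (∈-filter⁻ P? {xs = allFin n} (∈-lookup j))
  ; element-onto = λ Px → let x∈xs = ∈-filter⁺ P? (∈-allFin _) Px in index x∈xs , sym (lookup-index x∈xs)
  }
  where xs = filter P? (allFin n)

-- Rootings

lower upper : ∀ {n} → (Fin n → ℕ) → Fin n → Fin n → Fin n
lower h a b = if ⌊ h a ℕ.<? h b ⌋ then a else b
upper h a b = if ⌊ h a ℕ.<? h b ⌋ then b else a

lower-upper : ∀ {n} (h : Fin n → ℕ) a b →
  (lower h a b ≡ a × upper h a b ≡ b) ⊎ (lower h a b ≡ b × upper h a b ≡ a)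
lower-upper h a b with h a ℕ.<? h b
... | yes _ = inj₁ (refl , refl)
... | no _ = inj₂ (refl , refl)

endpoint-cases : ∀ {n} (h : Fin n → ℕ) a b t →
  t ≡ lower h a b ⊎ t ≡ upper h a b ⊎ (a ≢ t × b ≢ t)
endpoint-cases h a b t with lower-upper h a b | t ≟ a | t ≟ b
... | inj₁ (l≡a , _) | yes t≡a | _ = inj₁ (trans t≡a (sym l≡a))
... | inj₂ (_ , u≡a) | yes t≡a | _ = inj₂ (inj₁ (trans t≡a (sym u≡a)))
... | inj₁ (_ , u≡b) | no _ | yes t≡b = inj₂ (inj₁ (trans t≡b (sym u≡b)))
... | inj₂ (l≡b , _) | no _ | yes t≡b = inj₁ (trans t≡b (sym l≡b))
... | _ | no t≢a | no t≢b = inj₂ (inj₂ (t≢a ∘ sym , t≢b ∘ sym))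

lower<upper : ∀ {n} (h : Fin n → ℕ) {a b} → h a ≢ h b → h (lower h a b) < h (upper h a b)
lower<upper h {a} {b} ha≢hb with h a ℕ.<? h b
... | yes ha<hb = ha<hb
... | no ha≮hb = ℕ.≤∧≢⇒< (ℕ.≮⇒≥ ha≮hb) (ha≢hb ∘ sym)

lower-< : ∀ {n} (h : Fin n → ℕ) {a b} → h a < h b → lower h a b ≡ a
lower-< h {a} {b} ha<hb with h a ℕ.<? h b
... | yes _ = refl
... | no ha≮hb = ⊥-elim (ha≮hb ha<hb)

lower-> : ∀ {n} (h : Fin n → ℕ) {a b} → h b < h a → lower h a b ≡ b
lower-> h {a} {b} hb<ha with h a ℕ.<? h b
... | yes ha<hb = ⊥-elim (ℕ.<-asym ha<hb hb<ha)
... | no _ = refl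

lower-shift : ∀ {n} (h h' : Fin n → ℕ) {a b} → h a ≡ suc (h' a) → h b ≡ suc (h' b) → lower h a b ≡ lower h' a b
lower-shift h h' {a} {b} ha hb with h a ℕ.<? h b | h' a ℕ.<? h' b
... | yes _ | yes _ = refl
... | no _ | no _ = refl
... | yes ha<hb | no h'a≮h'b = ⊥-elim (h'a≮h'b (ℕ.≤-pred (subst₂ _<_ ha hb ha<hb)))
... | no ha≮hb | yes h'a<h'b = ⊥-elim (ha≮hb (subst₂ _<_ (sym ha) (sym hb) (s≤s h'a<h'b)))

-- A rooting of E hangs every edge from its upper endpoint, so that each vertex is the lower
-- endpoint of at most one edge; the vertices that are lower endpoints of no edge are the roots.
record Rooting {n} (E : DiGraph n) : Set where
  field
    height : Fin n → ℕ
    height-separates : ∀ {a b} → E a b ≡ true → height a ≢ height b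
    lower-injective : ∀ {a b a' b'} → E a b ≡ true → E a' b' ≡ true →
      lower height a b ≡ lower height a' b' → a ≡ a' × b ≡ b'

-- Forests admit rootings

Edge : ℕ → Set
Edge n = Fin n × Fin n

_≟ᴱ_ : ∀ {n} → DecidableEquality (Edge n)
_≟ᴱ_ = Product.≡-dec _≟_ _≟_

_∈ᴱ_ : ∀ {n} → Edge n → DiGraph n → Set
e ∈ᴱ E = E (proj₁ e) (proj₂ e) ≡ true

Incident : ∀ {n} → Fin n → Edge n → Set
Incident x e = x ≡ proj₁ e ⊎ x ≡ proj₂ e

Joins : ∀ {n} → Edge n → Fin n → Fin n → Set
Joins e x y = e ≡ (x , y) ⊎ e ≡ (y , x)

joins-cases : ∀ {n} {e : Edge n} {x y x' y'} → Joins e x y → Joins e x' y' →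
  (x ≡ x' × y ≡ y') ⊎ (x ≡ y' × y ≡ x')
joins-cases (inj₁ refl) (inj₁ refl) = inj₁ (refl , refl)
joins-cases (inj₁ refl) (inj₂ refl) = inj₂ (refl , refl)
joins-cases (inj₂ refl) (inj₁ refl) = inj₂ (refl , refl)
joins-cases (inj₂ refl) (inj₂ refl) = inj₁ (refl , refl)

delete : ∀ {n} → DiGraph n → Edge n → DiGraph n
delete E e a b = E a b ∧ not ⌊ (a , b) ≟ᴱ e ⌋

delete-⊆ : ∀ {n} {E : DiGraph n} {e a b} → delete E e a b ≡ true → E a b ≡ true
delete-⊆ {E = E} {e} {a} {b} kept with E a b
... | true = refl

delete-≢ : ∀ {n} {E : DiGraph n} {e a b} → delete E e a b ≡ true → (a , b) ≢ e
delete-≢ {E = E} {e} {a} {b} kept ab≡e with E a b | (a , b) ≟ᴱ e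
... | true | no ab≢e = ab≢e ab≡e

deleted-or-kept : ∀ {n} {E : DiGraph n} e {a b} → E a b ≡ true → (a , b) ≡ e ⊎ delete E e a b ≡ true
deleted-or-kept {E = E} e {a} {b} Eab with (a , b) ≟ᴱ e
... | yes ab≡e = inj₁ ab≡e
... | no _ rewrite Eab = inj₂ refl

edgeCount : ∀ {n} → DiGraph n → ℕ
edgeCount E = sumℕ λ a → sumℕ λ b → if E a b then 1 else 0

sumℕ-cong : ∀ {k} {f g : Fin k → ℕ} → (∀ i → f i ≡ g i) → sumℕ f ≡ sumℕ g
sumℕ-cong {zero} f≗g = refl
sumℕ-cong {suc k} f≗g = cong₂ ℕ._+_ (f≗g zero) (sumℕ-cong (f≗g ∘ suc))

sumℕ-suc : ∀ {k} (f g : Fin k → ℕ) i → (∀ j → j ≢ i → f j ≡ g j) → f i ≡ suc (g i) →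
  sumℕ f ≡ suc (sumℕ g)
sumℕ-suc f g zero agree fi≡1+gi = cong₂ ℕ._+_ fi≡1+gi (sumℕ-cong λ j → agree (suc j) λ ())
sumℕ-suc f g (suc i) agree fi≡1+gi = trans
  (cong₂ ℕ._+_ (agree zero λ ())
    (sumℕ-suc (f ∘ suc) (g ∘ suc) i (λ j j≢i → agree (suc j) (j≢i ∘ Fin.suc-injective)) fi≡1+gi))
  (ℕ.+-suc _ _)

edgeCount-delete : ∀ {n} {E : DiGraph n} {e} → e ∈ᴱ E → edgeCount E ≡ suc (edgeCount (delete E e))
edgeCount-delete {E = E} {p , q} Epq = sumℕ-suc _ _ p
  (λ a a≢p → sumℕ-cong λ b → cong (λ z → if z then 1 else 0) (sym (kept {a} {b} (a≢p ∘ cong proj₁))))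
  (sumℕ-suc _ _ q (λ b b≢q → cong (λ z → if z then 1 else 0) (sym (kept {p} {b} (b≢q ∘ cong proj₂)))) deleted)
  where
  kept : ∀ {a b} → (a , b) ≢ (p , q) → delete E (p , q) a b ≡ E a b
  kept {a} {b} ab≢pq with (a , b) ≟ᴱ (p , q)
  ... | yes ab≡pq = ⊥-elim (ab≢pq ab≡pq)
  ... | no _ = Bool.∧-identityʳ (E a b)
  deleted : (if E p q then 1 else 0) ≡ suc (if delete E (p , q) p q then 1 else 0)
  deleted rewrite Epq with (p , q) ≟ᴱ (p , q)
  ... | yes _ = refl
  ... | no pq≢pq = ⊥-elim (pq≢pq refl)

forest-⊆ : ∀ {n} {E E' : DiGraph n} → (∀ {a b} → E' a b ≡ true → E a b ≡ true) → IsForest E → IsForest E'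
forest-⊆ E'⊆E forest (k , v , dir , v-inj , step-inj , step-∈) =
  forest (k , v , dir , v-inj , step-inj , E'⊆E ∘ step-∈)

forest-loopless : ∀ {n} {E : DiGraph n} → IsForest E → ∀ {a} → E a a ≢ true
forest-loopless forest {a} Eaa = forest (0 , (λ _ → a) , (λ _ → true) ,
  (λ { zero zero _ → refl }) , (λ { zero zero _ → refl }) , λ { zero → Eaa })

AnotherEdgeAt : ∀ {n} → DiGraph n → Edge n → Fin n → Set
AnotherEdgeAt E e x = ∃ λ e' → e' ∈ᴱ E × Incident x e' × e' ≢ e

anotherEdgeAt? : ∀ {n} (E : DiGraph n) e x → Dec (AnotherEdgeAt E e x)
anotherEdgeAt? E e x with Fin.any? (λ a → Fin.any? λ b →
  (E a b Bool.≟ true) ×-dec ((x ≟ a) ⊎-dec (x ≟ b)) ×-dec ¬? ((a , b) ≟ᴱ e))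
... | yes (a , b , found) = yes ((a , b) , found)
... | no none = no λ ((a , b) , found) → none (a , b , found)

Leaf : ∀ {n} → DiGraph n → Set
Leaf E = ∃₂ λ e x → e ∈ᴱ E × Incident x e × ¬ AnotherEdgeAt E e x

leaf? : ∀ {n} (E : DiGraph n) → Dec (Leaf E)
leaf? E with Fin.any? (λ p → Fin.any? λ q → Fin.any? λ x →
  (E p q Bool.≟ true) ×-dec ((x ≟ p) ⊎-dec (x ≟ q)) ×-dec ¬? (anotherEdgeAt? E (p , q) x))
... | yes (p , q , x , found) = yes ((p , q) , x , found)
... | no none = no λ ((p , q) , x , found) → none (p , q , x , found)

lonely⇒avoids : ∀ {n} {E : DiGraph n} {e x a b} → ¬ AnotherEdgeAt E e x → delete E e a b ≡ true → a ≢ x × b ≢ x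
lonely⇒avoids {E = E} lonely kept =
  (λ a≡x → lonely (_ , delete-⊆ {E = E} kept , inj₁ (sym a≡x) , delete-≢ {E = E} kept)) ,
  (λ b≡x → lonely (_ , delete-⊆ {E = E} kept , inj₂ (sym b≡x) , delete-≢ {E = E} kept))

lower-≢ : ∀ {n} (h : Fin n → ℕ) {a b x} → a ≢ x → b ≢ x → lower h a b ≢ x
lower-≢ h {a} {b} a≢x b≢x with lower-upper h a b
... | inj₁ (l≡a , _) = λ l≡x → a≢x (trans (sym l≡a) l≡x)
... | inj₂ (l≡b , _) = λ l≡x → b≢x (trans (sym l≡b) l≡x)

bottomAt : ∀ {n} → Fin n → (Fin n → ℕ) → Fin n → ℕ
bottomAt x h y = if ⌊ y ≟ x ⌋ then 0 else suc (h y)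

bottomAt-other : ∀ {n} {x y : Fin n} h → y ≢ x → bottomAt x h y ≡ suc (h y)
bottomAt-other {x = x} {y} h y≢x with y ≟ x
... | yes y≡x = ⊥-elim (y≢x y≡x)
... | no _ = refl

bottomAt-lowest : ∀ {n} {x y : Fin n} h → y ≢ x → bottomAt x h x < bottomAt x h y
bottomAt-lowest {x = x} h y≢x with x ≟ x
... | yes _ = subst (0 <_) (sym (bottomAt-other h y≢x)) (s≤s z≤n)
... | no x≢x = ⊥-elim (x≢x refl)

rooting-extend : ∀ {n} {E : DiGraph n} {e x} → IsForest E → e ∈ᴱ E → Incident x e → ¬ AnotherEdgeAt E e x →
  Rooting (delete E e) → Rooting E
rooting-extend {n} {E} {e} {x} forest e∈E x∈e lonely ρ = record
  { height = height
  ; height-separates = separates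
  ; lower-injective = injective
  }
  where
  open Rooting ρ renaming (height to height'; height-separates to separates'; lower-injective to injective')
  height : Fin n → ℕ
  height = bottomAt x height'
  lower-kept : ∀ {a b} → delete E e a b ≡ true → lower height a b ≡ lower height' a b
  lower-kept kept = let a≢x , b≢x = lonely⇒avoids {E = E} lonely kept in
    lower-shift height height' (bottomAt-other height' a≢x) (bottomAt-other height' b≢x)
  lower-kept-≢ : ∀ {a b} → delete E e a b ≡ true → lower height a b ≢ x
  lower-kept-≢ kept = let a≢x , b≢x = lonely⇒avoids {E = E} lonely kept in lower-≢ height a≢x b≢x
  endpoints-differ : proj₁ e ≢ proj₂ e
  endpoints-differ p≡q = forest-loopless {E = E} forest (subst (λ z → E (proj₁ e) z ≡ true) (sym p≡q) e∈E)
  lower-leaf : Incident x e → lower height (proj₁ e) (proj₂ e) ≡ x × height (proj₁ e) ≢ height (proj₂ e)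
  lower-leaf (inj₁ x≡p) =
    let p<q = subst (λ z → height z < height (proj₂ e)) x≡p
                    (bottomAt-lowest height' λ q≡x → endpoints-differ (trans (sym x≡p) (sym q≡x)))
    in trans (lower-< height p<q) (sym x≡p) , ℕ.<⇒≢ p<q
  lower-leaf (inj₂ x≡q) =
    let q<p = subst (λ z → height z < height (proj₁ e)) x≡q
                    (bottomAt-lowest height' λ p≡x → endpoints-differ (trans p≡x x≡q))
    in trans (lower-> height q<p) (sym x≡q) , ℕ.<⇒≢ q<p ∘ sym
  lower-deleted : ∀ {a b} → (a , b) ≡ e → lower height a b ≡ x
  lower-deleted ab≡e = subst (λ f → lower height (proj₁ f) (proj₂ f) ≡ x) (sym ab≡e) (proj₁ (lower-leaf x∈e))
  separates : ∀ {a b} → E a b ≡ true → height a ≢ height b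
  separates {a} {b} Eab with deleted-or-kept {E = E} e {a} {b} Eab
  ... | inj₁ ab≡e = subst (λ f → height (proj₁ f) ≢ height (proj₂ f)) (sym ab≡e) (proj₂ (lower-leaf x∈e))
  ... | inj₂ kept = let a≢x , b≢x = lonely⇒avoids {E = E} lonely kept in λ ha≡hb →
    separates' kept (ℕ.suc-injective
      (trans (sym (bottomAt-other height' a≢x)) (trans ha≡hb (bottomAt-other height' b≢x))))
  injective : ∀ {a b a' b'} → E a b ≡ true → E a' b' ≡ true →
    lower height a b ≡ lower height a' b' → a ≡ a' × b ≡ b'
  injective {a} {b} {a'} {b'} Eab Ea'b' same
    with deleted-or-kept {E = E} e {a} {b} Eab | deleted-or-kept {E = E} e {a'} {b'} Ea'b'
  ... | inj₁ ab≡e | inj₁ a'b'≡e = Product.,-injective (trans ab≡e (sym a'b'≡e))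
  ... | inj₁ ab≡e | inj₂ kept' = ⊥-elim (lower-kept-≢ kept' (trans (sym same) (lower-deleted ab≡e)))
  ... | inj₂ kept | inj₁ a'b'≡e = ⊥-elim (lower-kept-≢ kept (trans same (lower-deleted a'b'≡e)))
  ... | inj₂ kept | inj₂ kept' = injective' kept kept' (trans (sym (lower-kept kept)) (trans same (lower-kept kept')))

record NonBacktrackingWalk {n} (E : DiGraph n) : Set where
  field
    vertex : ℕ → Fin n
    edge : ℕ → Edge n
    edge-∈ : ∀ i → edge i ∈ᴱ E
    edge-joins : ∀ i → Joins (edge i) (vertex i) (vertex (suc i))
    no-backtrack : ∀ i → edge (suc i) ≢ edge i

module LeaflessWalk {n} (E : DiGraph n)
  (another : ∀ {e x} → e ∈ᴱ E → Incident x e → AnotherEdgeAt E e x) where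

  other : Edge n → Fin n → Fin n
  other (p , q) x = if ⌊ p ≟ x ⌋ then q else p

  other-incident : ∀ e x → Incident (other e x) e
  other-incident (p , q) x with p ≟ x
  ... | yes _ = inj₂ refl
  ... | no _ = inj₁ refl

  joins-other : ∀ {e x} → Incident x e → Joins e x (other e x)
  joins-other {p , q} {x} x∈e with p ≟ x | x∈e
  ... | yes refl | _ = inj₁ refl
  ... | no p≢x | inj₁ x≡p = ⊥-elim (p≢x (sym x≡p))
  ... | no _ | inj₂ refl = inj₂ refl

  record Position : Set where
    field
      edge : Edge n
      vertex : Fin n
      edge-∈ : edge ∈ᴱ E
      incident : Incident vertex edge

  step : Position → Position
  step s = record { edge = e' ; vertex = other e' (vertex s) ; edge-∈ = e'∈E ; incident = other-incident e' (vertex s) }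
    where
    open Position
    e' = proj₁ (another (edge-∈ s) (incident s))
    e'∈E = proj₁ (proj₂ (another (edge-∈ s) (incident s)))

  walk : ∀ {e} → e ∈ᴱ E → NonBacktrackingWalk E
  walk {e} e∈E = record
    { vertex = vertex
    ; edge = Position.edge ∘ position
    ; edge-∈ = Position.edge-∈ ∘ position
    ; edge-joins = joins
    ; no-backtrack = λ i → proj₂ (proj₂ (proj₂ (onward (position i))))
    }
    where
    onward : (s : Position) → AnotherEdgeAt E (Position.edge s) (Position.vertex s)
    onward s = another (Position.edge-∈ s) (Position.incident s)
    position : ℕ → Position
    position zero = record { edge = e ; vertex = proj₂ e ; edge-∈ = e∈E ; incident = inj₂ refl }
    position (suc i) = step (position i)
    vertex : ℕ → Fin n
    vertex zero = proj₁ e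
    vertex (suc i) = Position.vertex (position i)
    joins : ∀ i → Joins (Position.edge (position i)) (vertex i) (vertex (suc i))
    joins zero = inj₁ refl
    joins (suc i) = joins-other (proj₁ (proj₂ (proj₂ (onward (position i)))))

shift : ∀ {n} {E : DiGraph n} → NonBacktrackingWalk E → ℕ → NonBacktrackingWalk E
shift W I = record
  { vertex = λ p → vertex (I ℕ.+ p)
  ; edge = λ p → edge (I ℕ.+ p)
  ; edge-∈ = λ p → edge-∈ (I ℕ.+ p)
  ; edge-joins = λ p →
      subst (Joins (edge (I ℕ.+ p)) (vertex (I ℕ.+ p))) (cong vertex (sym (ℕ.+-suc I p))) (edge-joins (I ℕ.+ p))
  ; no-backtrack = λ p → subst (λ z → edge z ≢ edge (I ℕ.+ p)) (sym (ℕ.+-suc I p)) (no-backtrack (I ℕ.+ p))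
  }
  where open NonBacktrackingWalk W

isForward : ∀ {n} {e : Edge n} {x y} → Joins e x y → Bool
isForward (inj₁ _) = true
isForward (inj₂ _) = false

orientation : ∀ {n} {e : Edge n} {x y} (j : Joins e x y) →
  (if isForward j then (x , y) else (y , x)) ≡ e
orientation (inj₁ e≡xy) = sym e≡xy
orientation (inj₂ e≡yx) = sym e≡yx

closedWalk⇒cycle : ∀ {n} {E : DiGraph n} (W : NonBacktrackingWalk E) K →
  let open NonBacktrackingWalk W in
  vertex (suc K) ≡ vertex 0 → (∀ {p q} → p < q → q ≤ K → vertex p ≢ vertex q) → HasCycle E
closedWalk⇒cycle {E = E} W K closed no-repeat = K , v , dir , v-injective , step-injective , step-∈
  where
  open NonBacktrackingWalk W
  distinct : ∀ {p q} → p ≤ K → q ≤ K → vertex p ≡ vertex q → p ≡ q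
  distinct {p} {q} p≤K q≤K same with ℕ.<-cmp p q
  ... | tri< p<q _ _ = ⊥-elim (no-repeat p<q q≤K same)
  ... | tri≈ _ p≡q _ = p≡q
  ... | tri> _ _ q<p = ⊥-elim (no-repeat q<p p≤K (sym same))
  v : Fin (suc K) → _
  v t = vertex (toℕ t)
  dir : Fin (suc K) → Bool
  dir t = isForward (edge-joins (toℕ t))
  toℕ≤K : ∀ (t : Fin (suc K)) → toℕ t ≤ K
  toℕ≤K t = ℕ.≤-pred (Fin.toℕ<n t)
  v-next : ∀ t → v (next t) ≡ vertex (suc (toℕ t))
  v-next t with toℕ t ℕ.<? K
  ... | yes t<K = cong vertex (Fin.toℕ-fromℕ< (s≤s t<K))
  ... | no t≮K = trans (sym closed) (cong (vertex ∘ suc) (ℕ.≤-antisym (ℕ.≮⇒≥ t≮K) (toℕ≤K t)))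
  step≡edge : ∀ t → stepEdge v dir t ≡ edge (toℕ t)
  step≡edge t = trans (cong (λ z → if dir t then (v t , z) else (z , v t)) (v-next t)) (orientation (edge-joins (toℕ t)))
  -- Two edges of the closed walk can only coincide if K = 1 and it returns along its first edge.
  edges-distinct : ∀ {p q} → p < q → q ≤ K → edge p ≢ edge q
  edges-distinct {p} {q} p<q q≤K ep≡eq
    with joins-cases (edge-joins p) (subst (λ f → Joins f (vertex q) (vertex (suc q))) (sym ep≡eq) (edge-joins q))
  ... | inj₁ (vp≡vq , _) = ℕ.<⇒≢ p<q (distinct (ℕ.<⇒≤ (ℕ.<-≤-trans p<q q≤K)) q≤K vp≡vq)
  ... | inj₂ (vp≡v1+q , v1+p≡vq) with ℕ.m≤n⇒m<n∨m≡n q≤K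
  ...   | inj₁ q<K = ℕ.<-asym p<q (subst (q <_) (sym p≡1+q) (ℕ.n<1+n q))
    where p≡1+q = distinct (ℕ.<⇒≤ (ℕ.<-≤-trans p<q q≤K)) q<K vp≡v1+q
  ...   | inj₂ q≡K = no-backtrack 0 (trans (cong edge 1≡q) (trans (sym ep≡eq) (cong edge p≡0)))
    where
    p≡0 : p ≡ 0
    p≡0 = distinct (ℕ.<⇒≤ (ℕ.<-≤-trans p<q q≤K)) z≤n
            (trans vp≡v1+q (trans (cong (vertex ∘ suc) q≡K) closed))
    1≡q : 1 ≡ q
    1≡q = distinct (subst (λ z → suc z ≤ K) p≡0 (ℕ.<-≤-trans p<q q≤K)) q≤K
            (trans (cong (vertex ∘ suc) (sym p≡0)) v1+p≡vq)
  v-injective : ∀ s t → v s ≡ v t → s ≡ t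
  v-injective s t vs≡vt = Fin.toℕ-injective (distinct (toℕ≤K s) (toℕ≤K t) vs≡vt)
  step-injective : ∀ s t → stepEdge v dir s ≡ stepEdge v dir t → s ≡ t
  step-injective s t same with ℕ.<-cmp (toℕ s) (toℕ t)
  ... | tri< s<t _ _ =
    ⊥-elim (edges-distinct s<t (toℕ≤K t) (trans (sym (step≡edge s)) (trans same (step≡edge t))))
  ... | tri≈ _ s≡t _ = Fin.toℕ-injective s≡t
  ... | tri> _ _ t<s =
    ⊥-elim (edges-distinct t<s (toℕ≤K s) (trans (sym (step≡edge t)) (trans (sym same) (step≡edge s))))
  step-∈ : ∀ t → E (proj₁ (stepEdge v dir t)) (proj₂ (stepEdge v dir t)) ≡ true
  step-∈ t = subst (_∈ᴱ E) (sym (step≡edge t)) (edge-∈ (toℕ t))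

least : ∀ {P : Pred ℕ 0ℓ} → Decidable P → ∀ j → P j → ∃ λ i → P i × (∀ {k} → k < i → ¬ P k)
least {P} P? = <-rec (λ j → P j → Least) search
  where
  Least = ∃ λ i → P i × (∀ {k} → k < i → ¬ P k)
  search : ∀ j → (∀ {i} → i < j → P i → Least) → P j → Least
  search j rec Pj with Fin.any? (λ (k : Fin j) → P? (toℕ k))
  ... | yes (k , Pk) = rec (Fin.toℕ<n k) Pk
  ... | no none = j , Pj , λ k<j Pk → none (fromℕ< k<j , subst P (sym (Fin.toℕ-fromℕ< k<j)) Pk)

firstRepeat : ∀ {n} (f : ℕ → Fin n) →
  ∃₂ λ I K → f (I ℕ.+ suc K) ≡ f I × (∀ {p q} → p < q → q ≤ K → f (I ℕ.+ p) ≢ f (I ℕ.+ q))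
firstRepeat {n} f = first (least repeat? _ (proj₂ some-repeat))
  where
  Repeat : Pred ℕ 0ℓ
  Repeat j = ∃ λ (i : Fin j) → f (toℕ i) ≡ f j
  repeat? : Decidable Repeat
  repeat? j = Fin.any? λ i → f (toℕ i) ≟ f j
  some-repeat : ∃ Repeat
  some-repeat with Fin.pigeonhole (ℕ.n<1+n n) (f ∘ toℕ)
  ... | i , j , i<j , fi≡fj = toℕ j , fromℕ< i<j , trans (cong f (Fin.toℕ-fromℕ< i<j)) fi≡fj
  first : (∃ λ J → Repeat J × (∀ {k} → k < J → ¬ Repeat k)) →
    ∃₂ λ I K → f (I ℕ.+ suc K) ≡ f I × (∀ {p q} → p < q → q ≤ K → f (I ℕ.+ p) ≢ f (I ℕ.+ q))
  first (J , (i , fi≡fJ) , earliest) with ℕ.m≤n⇒∃[o]m+o≡n (Fin.toℕ<n i)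
  ... | K , 1+i+K≡J = toℕ i , K , trans (cong f (trans (ℕ.+-suc (toℕ i) K) 1+i+K≡J)) (sym fi≡fJ) , no-repeat
    where
    no-repeat : ∀ {p q} → p < q → q ≤ K → f (toℕ i ℕ.+ p) ≢ f (toℕ i ℕ.+ q)
    no-repeat {p} {q} p<q q≤K fp≡fq =
      earliest (subst (toℕ i ℕ.+ q <_) 1+i+K≡J (s≤s (ℕ.+-monoʳ-≤ (toℕ i) q≤K)))
      (fromℕ< (ℕ.+-monoʳ-< (toℕ i) p<q) , trans (cong f (Fin.toℕ-fromℕ< (ℕ.+-monoʳ-< (toℕ i) p<q))) fp≡fq)

walk⇒cycle : ∀ {n} {E : DiGraph n} → NonBacktrackingWalk E → HasCycle E
walk⇒cycle W with firstRepeat (NonBacktrackingWalk.vertex W)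
... | I , K , closed , no-repeat =
  closedWalk⇒cycle (shift W I) K (trans closed (cong (NonBacktrackingWalk.vertex W) (sym (ℕ.+-identityʳ I)))) no-repeat

edgeless-rooting : ∀ {n} {E : DiGraph n} → (∀ {a b} → E a b ≢ true) → Rooting E
edgeless-rooting edgeless = record
  { height = λ _ → 0
  ; height-separates = λ Eab → ⊥-elim (edgeless Eab)
  ; lower-injective = λ Eab → ⊥-elim (edgeless Eab)
  }

leafless⇒another : ∀ {n} {E : DiGraph n} → ¬ Leaf E → ∀ {e x} → e ∈ᴱ E → Incident x e → AnotherEdgeAt E e x
leafless⇒another {E = E} leafless {e} {x} e∈E x∈e with anotherEdgeAt? E e x
... | yes found = found
... | no none = ⊥-elim (leafless (e , x , e∈E , x∈e , none))

rooting-by-leaves : ∀ {n} m {E : DiGraph n} → edgeCount E < m → IsForest E → Rooting E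
rooting-by-leaves (suc m) {E} count<1+m forest with Fin.any? (λ a → Fin.any? λ b → E a b Bool.≟ true)
... | no edgeless = edgeless-rooting λ {a} {b} Eab → edgeless (a , b , Eab)
... | yes (a , b , Eab) with leaf? E
...   | no leafless = ⊥-elim (forest (walk⇒cycle (LeaflessWalk.walk E (leafless⇒another leafless) {a , b} Eab)))
...   | yes (e , x , e∈E , x∈e , lonely) = rooting-extend forest e∈E x∈e lonely
  (rooting-by-leaves m (subst (_≤ m) (edgeCount-delete {E = E} e∈E) (ℕ.≤-pred count<1+m))
                       (forest-⊆ (λ {a} {b} → delete-⊆ {E = E} {e} {a} {b}) forest))

forest⇒rooting : ∀ {n} {E : DiGraph n} → IsForest E → Rooting E
forest⇒rooting {E = E} = rooting-by-leaves (suc (edgeCount E)) (ℕ.n<1+n _)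

-- Linear algebra of edge vectors

next-inject₁ : ∀ {k} (i : Fin k) → next (inject₁ i) ≡ suc i
next-inject₁ {k} i with toℕ (inject₁ i) ℕ.<? k
... | yes p = Fin.toℕ-injective (trans (Fin.toℕ-fromℕ< (s≤s p)) (cong suc (Fin.toℕ-inject₁ i)))
... | no q = ⊥-elim (q (subst (_< k) (sym (Fin.toℕ-inject₁ i)) (Fin.toℕ<n i)))

next-fromℕ : ∀ k → next (fromℕ k) ≡ zero
next-fromℕ k with toℕ (fromℕ k) ℕ.<? k
... | yes p = ⊥-elim (ℕ.<-irrefl (Fin.toℕ-fromℕ k) p)
... | no _ = refl

module Linear (R : CommutativeRing 0ℓ 0ℓ)
             (≈⇒≡ : ∀ {x y} → CommutativeRing._≈_ R x y → x ≡ y) where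

  open CommutativeRing R hiding (refl; sym; trans; zero)
  open import Algebra.Properties.CommutativeMonoid.Sum +-commutativeMonoid public
    using (sum; sum-cong-≗; sum-replicate-zero; sum-init-last; ∑-distrib-+; ∑-comm)
  open import Algebra.Properties.Semiring.Sum semiring using (*-distribˡ-sum; *-distribʳ-sum)
  open import Algebra.Properties.Ring ring
    using ( -0#≈0#; -‿+-comm; ⁻¹-anti-homo‿-; -1*x≈-x; -‿involutive; -‿distribʳ-*; -‿distribˡ-*
          ; x[y-z]≈xy-xz; x∙y⁻¹≈ε⇒x≈y)
  open ≡-Reasoning

  sum-zero : ∀ {k} {f : Fin k → Carrier} → (∀ i → f i ≡ 0#) → sum f ≡ 0#
  sum-zero {k} f≗0 = trans (sum-cong-≗ f≗0) (≈⇒≡ (sum-replicate-zero k))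

  sum-single : ∀ {k} (f : Fin k → Carrier) i → (∀ j → j ≢ i → f j ≡ 0#) → sum f ≡ f i
  sum-single f zero off =
    trans (cong (f zero +_) (sum-zero λ j → off (suc j) λ ())) (≈⇒≡ (+-identityʳ _))
  sum-single f (suc i) off =
    trans (cong₂ _+_ (off zero λ ()) (sum-single (f ∘ suc) i λ j j≢i → off (suc j) (j≢i ∘ Fin.suc-injective)))
          (≈⇒≡ (+-identityˡ _))

  sum-single₂ : ∀ {k m} (F : Fin k → Fin m → Carrier) i j →
    (∀ i' j' → (i' , j') ≢ (i , j) → F i' j' ≡ 0#) → sum (λ i' → sum (F i')) ≡ F i j
  sum-single₂ F i j off = trans
    (sum-single _ i λ i' i'≢i → sum-zero λ j' → off i' j' (i'≢i ∘ cong proj₁))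
    (sum-single (F i) j λ j' j'≢j → off i j' (j'≢j ∘ cong proj₂))

  sum-neg : ∀ {k} (f : Fin k → Carrier) → sum (λ i → - f i) ≡ - sum f
  sum-neg {zero} f = sym (≈⇒≡ -0#≈0#)
  sum-neg {suc k} f = trans (cong (- f zero +_) (sum-neg (f ∘ suc))) (≈⇒≡ (-‿+-comm _ _))

  sum-minus : ∀ {k} (f g : Fin k → Carrier) → sum (λ i → f i - g i) ≡ sum f - sum g
  sum-minus f g = trans (≈⇒≡ (∑-distrib-+ f (λ i → - g i))) (cong (sum f +_) (sum-neg g))

  sum-next : ∀ {k} (f : Fin (suc k) → Carrier) → sum (f ∘ next) ≡ sum f
  sum-next {k} f = begin
    sum (f ∘ next)                                   ≡⟨ ≈⇒≡ (sum-init-last (f ∘ next)) ⟩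
    sum (f ∘ next ∘ inject₁) + f (next (fromℕ k))    ≡⟨ cong₂ _+_ (sum-cong-≗ (cong f ∘ next-inject₁))
                                                                   (cong f (next-fromℕ k)) ⟩
    sum (f ∘ suc) + f zero                           ≡⟨ ≈⇒≡ (+-comm _ _) ⟩
    sum f                                            ∎

  sum-agree-except : ∀ {k} (f g : Fin k → Carrier) i → sum f ≡ sum g → (∀ j → j ≢ i → f j ≡ g j) →
    f i ≡ g i
  sum-agree-except f g i Σf≡Σg agree = ≈⇒≡ (x∙y⁻¹≈ε⇒x≈y _ _ (reflexive (begin
    f i - g i                    ≡⟨ sum-single (λ j → f j - g j) i (λ j j≢i → trans (cong (_- g j) (agree j j≢i))
                                                                                   (≈⇒≡ (-‿inverseʳ (g j)))) ⟨
    sum (λ j → f j - g j)        ≡⟨ sum-minus f g ⟩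
    sum f - sum g                ≡⟨ cong (_- sum g) Σf≡Σg ⟩
    sum g - sum g                ≡⟨ ≈⇒≡ (-‿inverseʳ (sum g)) ⟩
    0#                           ∎)))

  δ : ∀ {n} → Fin n → Fin n → Carrier
  δ a t = if ⌊ a ≟ t ⌋ then 1# else 0#

  δ-diag : ∀ {n} (a : Fin n) → δ a a ≡ 1#
  δ-diag a with a ≟ a
  ... | yes _ = refl
  ... | no a≢a = ⊥-elim (a≢a refl)

  δ-off : ∀ {n} {a t : Fin n} → a ≢ t → δ a t ≡ 0#
  δ-off {a = a} {t} a≢t with a ≟ t
  ... | yes a≡t = ⊥-elim (a≢t a≡t)
  ... | no _ = refl

  sum-δ : ∀ {n} (a : Fin n) → sum (δ a) ≡ 1#
  sum-δ a = trans (sum-single (δ a) a λ t t≢a → δ-off (t≢a ∘ sym)) (δ-diag a)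

  *-δ-cong : ∀ {n} {u v} (a t : Fin n) → (a ≡ t → u ≡ v) → u * δ a t ≡ v * δ a t
  *-δ-cong a t agree with a ≟ t
  ... | yes a≡t = cong (_* 1#) (agree a≡t)
  ... | no _ = trans (≈⇒≡ (zeroʳ _)) (sym (≈⇒≡ (zeroʳ _)))

  edgeVec : ∀ {n} → Fin n → Fin n → Fin n → Carrier
  edgeVec a b t = δ b t - δ a t

  edgeVec-off : ∀ {n} {a b t : Fin n} → a ≢ t → b ≢ t → edgeVec a b t ≡ 0#
  edgeVec-off a≢t b≢t rewrite δ-off a≢t | δ-off b≢t = ≈⇒≡ (-‿inverseʳ 0#)

  edgeVec-head : ∀ {n} {a b : Fin n} → a ≢ b → edgeVec a b b ≡ 1#
  edgeVec-head {b = b} a≢b rewrite δ-diag b | δ-off a≢b =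
    trans (cong (1# +_) (≈⇒≡ -0#≈0#)) (≈⇒≡ (+-identityʳ 1#))

  edgeVec-tail : ∀ {n} {a b : Fin n} → a ≢ b → edgeVec a b a ≡ - 1#
  edgeVec-tail {a = a} a≢b rewrite δ-diag a | δ-off (a≢b ∘ sym) = ≈⇒≡ (+-identityˡ (- 1#))

  edgeVec-flip : ∀ {n} (a b t : Fin n) → - edgeVec a b t ≡ edgeVec b a t
  edgeVec-flip a b t = ≈⇒≡ (⁻¹-anti-homo‿- (δ b t) (δ a t))

  sum-edgeVec : ∀ {n} (a b : Fin n) → sum (edgeVec a b) ≡ 0#
  sum-edgeVec a b = begin
    sum (edgeVec a b)       ≡⟨ sum-minus (δ b) (δ a) ⟩
    sum (δ b) - sum (δ a)   ≡⟨ cong₂ _-_ (sum-δ b) (sum-δ a) ⟩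
    1# - 1#                 ≡⟨ ≈⇒≡ (-‿inverseʳ 1#) ⟩
    0#                      ∎

  sum-scaled-edgeVec : ∀ {n} x (a b : Fin n) → sum (λ t → x * edgeVec a b t) ≡ 0#
  sum-scaled-edgeVec x a b = begin
    sum (λ t → x * edgeVec a b t)   ≡⟨ ≈⇒≡ (*-distribˡ-sum x (edgeVec a b)) ⟨
    x * sum (edgeVec a b)          ≡⟨ cong (x *_) (sum-edgeVec a b) ⟩
    x * 0#                         ≡⟨ ≈⇒≡ (zeroʳ x) ⟩
    0#                             ∎

  edgeTerm : ∀ {n} → DiGraph n → (Fin n → Fin n → Carrier) → Fin n → Fin n → Fin n → Carrier
  edgeTerm E c t a b = if E a b then c a b * edgeVec a b t else 0#

  comb : ∀ {n} → DiGraph n → (Fin n → Fin n → Carrier) → Fin n → Carrier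
  comb E c t = sum λ a → sum λ b → edgeTerm E c t a b

  sum-comb : ∀ {n} (E : DiGraph n) c → sum (comb E c) ≡ 0#
  sum-comb {n} E c = begin
    sum (λ t → sum λ a → sum λ b → edgeTerm E c t a b)
      ≡⟨ ≈⇒≡ (∑-comm (λ t a → sum λ b → edgeTerm E c t a b)) ⟩
    sum (λ a → sum λ t → sum λ b → edgeTerm E c t a b)
      ≡⟨ sum-cong-≗ (λ a → ≈⇒≡ (∑-comm (λ t b → edgeTerm E c t a b))) ⟩
    sum (λ a → sum λ b → sum λ t → edgeTerm E c t a b)
      ≡⟨ sum-zero (λ a → sum-zero λ b → edge-total a b) ⟩
    0#
      ∎
    where
    edge-total : ∀ a b → sum (λ t → if E a b then c a b * edgeVec a b t else 0#) ≡ 0#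
    edge-total a b with E a b
    ... | false = sum-zero {n} λ _ → refl
    ... | true = sum-scaled-edgeVec (c a b) a b

  neg-zero : ∀ {x} → - x ≡ 0# → x ≡ 0#
  neg-zero {x} -x≡0 = begin
    x         ≡⟨ ≈⇒≡ (-‿involutive x) ⟨
    - (- x)   ≡⟨ cong -_ -x≡0 ⟩
    - 0#      ≡⟨ ≈⇒≡ -0#≈0# ⟩
    0#        ∎

  minus-rearrange : ∀ {p c x y} → p + x ≡ y + c → (p - c) + x ≡ y
  minus-rearrange {p} {c} {x} {y} p+x≡y+c = begin
    (p - c) + x      ≡⟨ ≈⇒≡ (+-assoc p (- c) x) ⟩
    p + (- c + x)    ≡⟨ cong (p +_) (≈⇒≡ (+-comm (- c) x)) ⟩
    p + (x - c)      ≡⟨ ≈⇒≡ (+-assoc p x (- c)) ⟨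
    (p + x) - c      ≡⟨ cong (_- c) p+x≡y+c ⟩
    (y + c) - c      ≡⟨ ≈⇒≡ (+-assoc y c (- c)) ⟩
    y + (c - c)      ≡⟨ cong (y +_) (≈⇒≡ (-‿inverseʳ c)) ⟩
    y + 0#           ≡⟨ ≈⇒≡ (+-identityʳ y) ⟩
    y                ∎

  NontrivialRelation : ∀ {n} → DiGraph n → Set
  NontrivialRelation {n} E = Σ (Fin n → Fin n → Carrier) λ c →
    (∀ t → comb E c t ≡ 0#) × ∃₂ λ a b → E a b ≡ true × c a b ≢ 0#

  coefficientsOf : ∀ {m n} → (Fin m → Edge n) → (Fin m → Carrier) → Fin n → Fin n → Carrier
  coefficientsOf e s a b = sum λ j → if ⌊ (a , b) ≟ᴱ e j ⌋ then s j else 0#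

  coefficientsOf-injective : ∀ {m n} {e : Fin m → Edge n} s → (∀ {i j} → e i ≡ e j → i ≡ j) →
    ∀ j → coefficientsOf e s (proj₁ (e j)) (proj₂ (e j)) ≡ s j
  coefficientsOf-injective {e = e} s e-injective j = trans (sum-single _ j off) (pick-diag (e j))
    where
    pick-diag : ∀ x → (if ⌊ x ≟ᴱ x ⌋ then s j else 0#) ≡ s j
    pick-diag x with x ≟ᴱ x
    ... | yes _ = refl
    ... | no x≢x = ⊥-elim (x≢x refl)
    off : ∀ i → i ≢ j → (if ⌊ e j ≟ᴱ e i ⌋ then s i else 0#) ≡ 0#
    off i i≢j with e j ≟ᴱ e i
    ... | yes ej≡ei = ⊥-elim (i≢j (e-injective (sym ej≡ei)))
    ... | no _ = refl

  comb-coefficientsOf : ∀ {m n} {E : DiGraph n} (e : Fin m → Edge n) s →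
    (∀ j → E (proj₁ (e j)) (proj₂ (e j)) ≡ true) →
    ∀ t → comb E (coefficientsOf e s) t ≡ sum λ j → s j * edgeVec (proj₁ (e j)) (proj₂ (e j)) t
  comb-coefficientsOf {m} {n} {E} e s e∈E t = begin
    sum (λ a → sum λ b → edgeTerm E c t a b)          ≡⟨ sum-cong-≗ (λ a → sum-cong-≗ λ b → split a b) ⟩
    sum (λ a → sum λ b → sum λ j → T j a b)           ≡⟨ sum-cong-≗ (λ a → ≈⇒≡ (∑-comm (λ b j → T j a b))) ⟩
    sum (λ a → sum λ j → sum λ b → T j a b)           ≡⟨ ≈⇒≡ (∑-comm (λ a j → sum λ b → T j a b)) ⟩
    sum (λ j → sum λ a → sum λ b → T j a b)           ≡⟨ sum-cong-≗ (λ j → sum-single₂ (λ a b → T j a b) _ _ (off j)) ⟩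
    sum (λ j → T j (proj₁ (e j)) (proj₂ (e j)))       ≡⟨ sum-cong-≗ on ⟩
    sum (λ j → s j * edgeVec (proj₁ (e j)) (proj₂ (e j)) t) ∎
    where
    c = coefficientsOf e s
    pick : Fin n → Fin n → Fin m → Carrier
    pick a b j = if ⌊ (a , b) ≟ᴱ e j ⌋ then s j else 0#
    T : Fin m → Fin n → Fin n → Carrier
    T j a b = if E a b then pick a b j * edgeVec a b t else 0#
    split : ∀ a b → edgeTerm E c t a b ≡ sum λ j → T j a b
    split a b with E a b
    ... | true = ≈⇒≡ (*-distribʳ-sum (edgeVec a b t) (pick a b))
    ... | false = sym (sum-zero {m} λ _ → refl)
    off : ∀ j a b → (a , b) ≢ e j → T j a b ≡ 0#
    off j a b ab≢ej with E a b | (a , b) ≟ᴱ e j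
    ... | false | _ = refl
    ... | true | no _ = ≈⇒≡ (zeroˡ _)
    ... | true | yes ab≡ej = ⊥-elim (ab≢ej ab≡ej)
    on : ∀ j → T j (proj₁ (e j)) (proj₂ (e j)) ≡ s j * edgeVec (proj₁ (e j)) (proj₂ (e j)) t
    on j rewrite e∈E j with e j ≟ᴱ e j
    ... | yes _ = refl
    ... | no ej≢ej = ⊥-elim (ej≢ej refl)

  signed-edgeVec : ∀ {n} (d : Bool) (x y t : Fin n) →
    let e = if d then (x , y) else (y , x) in
    (if d then 1# else - 1#) * edgeVec (proj₁ e) (proj₂ e) t ≡ edgeVec x y t
  signed-edgeVec true x y t = ≈⇒≡ (*-identityˡ _)
  signed-edgeVec false x y t = trans (≈⇒≡ (-1*x≈-x _)) (edgeVec-flip y x t)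

  sign-nonzero : 1# ≢ 0# → ∀ d → (if d then 1# else - 1#) ≢ 0#
  sign-nonzero 1≢0 true = 1≢0
  sign-nonzero 1≢0 false = 1≢0 ∘ neg-zero

  cycle-relation : ∀ {n} {E : DiGraph n} → 1# ≢ 0# → HasCycle E → NontrivialRelation E
  cycle-relation {E = E} 1≢0 (k , v , dir , _ , step-injective , step-∈E) =
    c , relation , proj₁ (step zero) , proj₂ (step zero) , step-∈E zero ,
    λ c≡0 → sign-nonzero 1≢0 (dir zero) (trans (sym (coefficientsOf-injective σ (step-injective _ _) zero)) c≡0)
    where
    step = stepEdge v dir
    σ : Fin (suc k) → Carrier
    σ j = if dir j then 1# else - 1#
    c = coefficientsOf step σ
    relation : ∀ t → comb E c t ≡ 0#
    relation t = begin
      comb E c t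
        ≡⟨ comb-coefficientsOf step σ step-∈E t ⟩
      sum (λ j → σ j * edgeVec (proj₁ (step j)) (proj₂ (step j)) t)
        ≡⟨ sum-cong-≗ (λ j → signed-edgeVec (dir j) (v j) (v (next j)) t) ⟩
      sum (λ j → δ (v (next j)) t - δ (v j) t)
        ≡⟨ sum-minus (λ j → δ (v (next j)) t) (λ j → δ (v j) t) ⟩
      sum (λ j → δ (v (next j)) t) - sum (λ j → δ (v j) t)
        ≡⟨ cong (_- sum (λ j → δ (v j) t)) (sum-next (λ j → δ (v j) t)) ⟩
      sum (λ j → δ (v j) t) - sum (λ j → δ (v j) t)
        ≡⟨ ≈⇒≡ (-‿inverseʳ _) ⟩
      0#
        ∎

  module Rooted {n} {E : DiGraph n} (ρ : Rooting E) where
    open Rooting ρ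

    low high : Fin n → Fin n → Fin n
    low = lower height
    high = upper height

    low<high : ∀ {a b} → E a b ≡ true → height (low a b) < height (high a b)
    low<high Eab = lower<upper height (height-separates Eab)

    cancel-at-low : ∀ {a b x} → E a b ≡ true → x * edgeVec a b (low a b) ≡ 0# → x ≡ 0#
    cancel-at-low {a} {b} {x} Eab x·v≡0 with low a b | lower-upper height a b
    ... | _ | inj₁ (refl , _) = neg-zero (begin
      - x                   ≡⟨ cong -_ (≈⇒≡ (*-identityʳ x)) ⟨
      - (x * 1#)            ≡⟨ ≈⇒≡ (-‿distribʳ-* x 1#) ⟩
      x * - 1#              ≡⟨ cong (x *_) (edgeVec-tail (height-separates Eab ∘ cong height)) ⟨
      x * edgeVec a b a     ≡⟨ x·v≡0 ⟩
      0#                    ∎)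
    ... | _ | inj₂ (refl , _) = begin
      x                     ≡⟨ ≈⇒≡ (*-identityʳ x) ⟨
      x * 1#                ≡⟨ cong (x *_) (edgeVec-head (height-separates Eab ∘ cong height)) ⟨
      x * edgeVec a b b     ≡⟨ x·v≡0 ⟩
      0#                    ∎

    comb-at-low : ∀ (c : Fin n → Fin n → Carrier) {a b} → E a b ≡ true →
      (∀ {a' b'} → E a' b' ≡ true → height (low a' b') < height (low a b) → c a' b' ≡ 0#) →
      comb E c (low a b) ≡ c a b * edgeVec a b (low a b)
    comb-at-low c {a} {b} Eab below = trans (sum-single₂ (edgeTerm E c t) a b off) (if-cong Eab)
      where
      t = low a b
      off : ∀ a' b' → (a' , b') ≢ (a , b) → (if E a' b' then c a' b' * edgeVec a' b' t else 0#) ≡ 0#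
      off a' b' ne with E a' b' in E'
      ... | false = refl
      ... | true with endpoint-cases height a' b' t
      ...   | inj₁ t≡low' = ⊥-elim (ne (Product.×-≡,≡→≡ (lower-injective E' Eab (sym t≡low'))))
      ...   | inj₂ (inj₁ t≡high') = begin
        c a' b' * edgeVec a' b' t  ≡⟨ cong (_* edgeVec a' b' t) (below E' (subst (λ z → height (low a' b') < height z)
                                                                              (sym t≡high') (low<high E'))) ⟩
        0# * edgeVec a' b' t       ≡⟨ ≈⇒≡ (zeroˡ _) ⟩
        0#                         ∎
      ...   | inj₂ (inj₂ (a'≢t , b'≢t)) = trans (cong (c a' b' *_) (edgeVec-off a'≢t b'≢t)) (≈⇒≡ (zeroʳ _))

    rooted-independent : ∀ (c : Fin n → Fin n → Carrier) (X : Fin n → Carrier) →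
      (∀ t → comb E c t + X t ≡ 0#) → (∀ {a b} → E a b ≡ true → X (low a b) ≡ 0#) →
      ∀ a b → E a b ≡ true → c a b ≡ 0#
    rooted-independent c X c+X≡0 X-low a b Eab = <-rec P step _ Eab refl
      where
      P : ℕ → Set
      P m = ∀ {a b} → E a b ≡ true → height (low a b) ≡ m → c a b ≡ 0#
      step : ∀ m → (∀ {m'} → m' < m → P m') → P m
      step _ rec {a} {b} Eab refl = cancel-at-low Eab (begin
        c a b * edgeVec a b (low a b)       ≡⟨ comb-at-low c Eab (λ E' lt → rec lt E' refl) ⟨
        comb E c (low a b)                  ≡⟨ ≈⇒≡ (+-identityʳ _) ⟨
        comb E c (low a b) + 0#             ≡⟨ cong (comb E c (low a b) +_) (X-low Eab) ⟨
        comb E c (low a b) + X (low a b)    ≡⟨ c+X≡0 (low a b) ⟩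
        0#                                  ∎)

    HasParent : Pred (Fin n) 0ℓ
    HasParent x = ∃₂ λ a b → E a b ≡ true × low a b ≡ x

    hasParent? : Decidable HasParent
    hasParent? x = Fin.any? λ a → Fin.any? λ b → (E a b Bool.≟ true) ×-dec (low a b ≟ x)

    parentSum childSum : (Fin n → Carrier) → Fin n → Carrier
    parentSum S x = sum λ a → sum λ b → if E a b then S (low a b) * δ (low a b) x else 0#
    childSum S x = sum λ a → sum λ b → if E a b then S (low a b) * δ (high a b) x else 0#

    parentSum-parent : ∀ S {x} → HasParent x → parentSum S x ≡ S x
    parentSum-parent S {x} (a , b , Eab , refl) = begin
      parentSum S x                ≡⟨ sum-single₂ _ a b off ⟩
      (if E a b then S x * δ x x else 0#) ≡⟨ if-cong Eab ⟩
      S x * δ x x                  ≡⟨ cong (S x *_) (δ-diag x) ⟩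
      S x * 1#                     ≡⟨ ≈⇒≡ (*-identityʳ (S x)) ⟩
      S x                          ∎
      where
      off : ∀ a' b' → (a' , b') ≢ (a , b) → (if E a' b' then S (low a' b') * δ (low a' b') x else 0#) ≡ 0#
      off a' b' ne with E a' b' in E'
      ... | false = refl
      ... | true = trans (cong (S (low a' b') *_) (δ-off λ same-low → ne (Product.×-≡,≡→≡ (lower-injective E' Eab same-low))))
                      (≈⇒≡ (zeroʳ _))

    parentSum-root : ∀ S {x} → ¬ HasParent x → parentSum S x ≡ 0#
    parentSum-root S {x} orphan = sum-zero λ a → sum-zero λ b → term a b
      where
      term : ∀ a b → (if E a b then S (low a b) * δ (low a b) x else 0#) ≡ 0#
      term a b with E a b in Eab
      ... | false = refl
      ... | true = trans (cong (S (low a b) *_) (δ-off λ low≡x → orphan (a , b , Eab , low≡x))) (≈⇒≡ (zeroʳ _))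

    childSum-cong : ∀ {S S'} x → (∀ {a b} → E a b ≡ true → high a b ≡ x → S (low a b) ≡ S' (low a b)) →
      childSum S x ≡ childSum S' x
    childSum-cong {S} {S'} x agree = sum-cong-≗ λ a → sum-cong-≗ λ b → term a b
      where
      term : ∀ a b → (if E a b then S (low a b) * δ (high a b) x else 0#) ≡
                     (if E a b then S' (low a b) * δ (high a b) x else 0#)
      term a b with E a b in Eab
      ... | false = refl
      ... | true = *-δ-cong (high a b) x (agree Eab)

    orient : (Fin n → Carrier) → Fin n → Fin n → Carrier
    orient S a b = if ⌊ height a ℕ.<? height b ⌋ then - S a else S b

    orient-edgeVec : ∀ S a b t →
      orient S a b * edgeVec a b t ≡ S (low a b) * δ (low a b) t - S (low a b) * δ (high a b) t
    orient-edgeVec S a b t with height a ℕ.<? height b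
    ... | yes _ = begin
      - S a * edgeVec a b t      ≡⟨ ≈⇒≡ (-‿distribˡ-* (S a) (edgeVec a b t)) ⟨
      - (S a * edgeVec a b t)    ≡⟨ ≈⇒≡ (-‿distribʳ-* (S a) (edgeVec a b t)) ⟩
      S a * - edgeVec a b t      ≡⟨ cong (S a *_) (edgeVec-flip a b t) ⟩
      S a * edgeVec b a t        ≡⟨ ≈⇒≡ (x[y-z]≈xy-xz (S a) (δ a t) (δ b t)) ⟩
      S a * δ a t - S a * δ b t  ∎
    ... | no _ = ≈⇒≡ (x[y-z]≈xy-xz (S b) (δ b t) (δ a t))

    comb-orient : ∀ S t → comb E (orient S) t ≡ parentSum S t - childSum S t
    comb-orient S t = begin
      comb E (orient S) t                                   ≡⟨ sum-cong-≗ (λ a → sum-cong-≗ λ b → term a b) ⟩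
      sum (λ a → sum λ b → P a b - C a b)                   ≡⟨ sum-cong-≗ (λ a → sum-minus (P a) (C a)) ⟩
      sum (λ a → sum (P a) - sum (C a))                     ≡⟨ sum-minus (λ a → sum (P a)) (λ a → sum (C a)) ⟩
      parentSum S t - childSum S t                          ∎
      where
      P C : Fin n → Fin n → Carrier
      P a b = if E a b then S (low a b) * δ (low a b) t else 0#
      C a b = if E a b then S (low a b) * δ (high a b) t else 0#
      term : ∀ a b → edgeTerm E (orient S) t a b ≡ P a b - C a b
      term a b with E a b
      ... | true = orient-edgeVec S a b t
      ... | false = sym (≈⇒≡ (-‿inverseʳ 0#))

    -- With enough fuel, subtreeSum y N x is the sum of y over x and the vertices hanging below it.
    subtreeSum : (Fin n → Carrier) → ℕ → Fin n → Carrier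
    subtreeSum y zero _ = 0#
    subtreeSum y (suc N) x = y x + childSum (subtreeSum y N) x

    subtreeSum-stable : ∀ y N x → height x < N → subtreeSum y N x ≡ subtreeSum y (suc N) x
    subtreeSum-stable y (suc N) x x<1+N =
      cong (y x +_) (childSum-cong {subtreeSum y N} {subtreeSum y (suc N)} x λ {a} {b} Eab high≡x →
        subtreeSum-stable y N (low a b)
        (ℕ.<-≤-trans (subst (λ z → height (low a b) < height z) high≡x (low<high Eab)) (ℕ.≤-pred x<1+N)))

    module Completion (r : Fin n) (r-top : ∀ x → height x ≤ height r)
                      (roots : Enumeration λ x → ¬ HasParent x × x ≢ r) where
      open Enumeration roots renaming (size to k; element to root)

      r-orphan : ¬ HasParent r
      r-orphan (a , b , Eab , refl) = ℕ.<⇒≱ (low<high Eab) (r-top (high a b))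

      extraComb : (Fin k → Carrier) → Fin n → Carrier
      extraComb d t = sum λ j → d j * edgeVec r (root j) t

      extraComb-parent : ∀ d {t} → HasParent t → extraComb d t ≡ 0#
      extraComb-parent d {t} parent = sum-zero λ j → trans
        (cong (d j *_) (edgeVec-off (λ r≡t → r-orphan (subst HasParent (sym r≡t) parent))
                                    (λ root≡t → proj₁ (element-satisfies j) (subst HasParent (sym root≡t) parent))))
        (≈⇒≡ (zeroʳ _))

      extraComb-root : ∀ d j → extraComb d (root j) ≡ d j
      extraComb-root d j = begin
        extraComb d (root j)              ≡⟨ sum-single _ j off ⟩
        d j * edgeVec r (root j) (root j) ≡⟨ cong (d j *_) (edgeVec-head (proj₂ (element-satisfies j) ∘ sym)) ⟩
        d j * 1#                          ≡⟨ ≈⇒≡ (*-identityʳ (d j)) ⟩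
        d j                               ∎
        where
        off : ∀ i → i ≢ j → d i * edgeVec r (root i) (root j) ≡ 0#
        off i i≢j = trans (cong (d i *_) (edgeVec-off (proj₂ (element-satisfies j) ∘ sym) (i≢j ∘ element-injective)))
                       (≈⇒≡ (zeroʳ _))

      sum-extraComb : ∀ d → sum (extraComb d) ≡ 0#
      sum-extraComb d = trans (≈⇒≡ (∑-comm (λ t j → d j * edgeVec r (root j) t)))
                              (sum-zero λ j → sum-scaled-edgeVec (d j) r (root j))

      completion-independent : ∀ c d → (∀ t → comb E c t + extraComb d t ≡ 0#) →
        (∀ a b → E a b ≡ true → c a b ≡ 0#) × (∀ j → d j ≡ 0#)
      completion-independent c d relation = c≡0 , d≡0
        where
        c≡0 : ∀ a b → E a b ≡ true → c a b ≡ 0#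
        c≡0 = rooted-independent c (extraComb d) relation λ {a} {b} Eab → extraComb-parent d (a , b , Eab , refl)
        comb≡0 : ∀ t → comb E c t ≡ 0#
        comb≡0 t = sum-zero λ a → sum-zero λ b → term a b
          where
          term : ∀ a b → (if E a b then c a b * edgeVec a b t else 0#) ≡ 0#
          term a b with E a b in Eab
          ... | false = refl
          ... | true = trans (cong (_* edgeVec a b t) (c≡0 a b Eab)) (≈⇒≡ (zeroˡ _))
        d≡0 : ∀ j → d j ≡ 0#
        d≡0 j = begin
          d j                                              ≡⟨ extraComb-root d j ⟨
          extraComb d (root j)                             ≡⟨ ≈⇒≡ (+-identityˡ _) ⟨
          0# + extraComb d (root j)                        ≡⟨ cong (_+ extraComb d (root j)) (comb≡0 (root j)) ⟨
          comb E c (root j) + extraComb d (root j)         ≡⟨ relation (root j) ⟩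
          0#                                               ∎

      parent-or-extra : ∀ S {t} → t ≢ r → parentSum S t + extraComb (S ∘ root) t ≡ S t
      parent-or-extra S {t} t≢r with hasParent? t
      ... | yes parent = begin
        parentSum S t + extraComb (S ∘ root) t  ≡⟨ cong₂ _+_ (parentSum-parent S parent) (extraComb-parent (S ∘ root) parent) ⟩
        S t + 0#                               ≡⟨ ≈⇒≡ (+-identityʳ (S t)) ⟩
        S t                                    ∎
      ... | no orphan with element-onto (orphan , t≢r)
      ...   | j , refl = begin
        parentSum S t + extraComb (S ∘ root) t  ≡⟨ cong₂ _+_ (parentSum-root S orphan) (extraComb-root (S ∘ root) j) ⟩
        0# + S t                               ≡⟨ ≈⇒≡ (+-identityˡ (S t)) ⟩
        S t                                    ∎

      completion-spanning : ∀ y → sum y ≡ 0# →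
        Σ (Fin n → Fin n → Carrier) λ c → Σ (Fin k → Carrier) λ d → ∀ t → y t ≡ comb E c t + extraComb d t
      completion-spanning y Σy≡0 = orient S , d , λ t → sym (represent t)
        where
        S : Fin n → Carrier
        S = subtreeSum y (suc (height r))
        d : Fin k → Carrier
        d = S ∘ root
        S-unfold : ∀ x → S x ≡ y x + childSum S x
        S-unfold x = cong (y x +_) (childSum-cong {subtreeSum y (height r)} {S} x λ {a} {b} Eab high≡x →
          subtreeSum-stable y (height r) (low a b)
            (ℕ.<-≤-trans (subst (λ z → height (low a b) < height z) high≡x (low<high Eab)) (r-top x)))
        V : Fin n → Carrier
        V t = comb E (orient S) t + extraComb d t
        represent-away : ∀ t → t ≢ r → V t ≡ y t
        represent-away t t≢r = trans (cong (_+ extraComb d t) (comb-orient S t))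
                                     (minus-rearrange (trans (parent-or-extra S t≢r) (S-unfold t)))
        sum-V : sum V ≡ sum y
        sum-V = begin
          sum V                                       ≡⟨ ≈⇒≡ (∑-distrib-+ (comb E (orient S)) (extraComb d)) ⟩
          sum (comb E (orient S)) + sum (extraComb d) ≡⟨ cong₂ _+_ (sum-comb E (orient S)) (sum-extraComb d) ⟩
          0# + 0#                                     ≡⟨ ≈⇒≡ (+-identityʳ 0#) ⟩
          0#                                          ≡⟨ Σy≡0 ⟨
          sum y                                       ∎
        represent : ∀ t → V t ≡ y t
        represent t with t ≟ r
        ... | no t≢r = represent-away t t≢r
        ... | yes refl = sum-agree-except V y t sum-V represent-away

-- The equivalences

module ℤ-Linear = Linear ℤ.+-*-commutativeRing (λ x≡y → x≡y)
module ℚ-Linear = Linear ℚ.+-*-commutativeRing (λ x≡y → x≡y)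

sumℤ≡sum : ∀ {k} (f : Fin k → ℤ) → sumℤ f ≡ ℤ-Linear.sum f
sumℤ≡sum {zero} f = refl
sumℤ≡sum {suc k} f = cong (λ s → f zero ℤ.+ s) (sumℤ≡sum (f ∘ suc))

sumℚ≡sum : ∀ {k} (f : Fin k → ℚ) → sumℚ f ≡ ℚ-Linear.sum f
sumℚ≡sum {zero} f = refl
sumℚ≡sum {suc k} f = cong (λ s → f zero ℚ.+ s) (sumℚ≡sum (f ∘ suc))

combℤ≡comb : ∀ {n} (E : DiGraph n) c t → combℤ E c t ≡ ℤ-Linear.comb E c t
combℤ≡comb E c t = trans (sumℤ≡sum (λ a → sumℤ (ℤ-Linear.edgeTerm E c t a)))
                          (ℤ-Linear.sum-cong-≗ λ a → sumℤ≡sum (ℤ-Linear.edgeTerm E c t a))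

combℚ≡comb : ∀ {n} (E : DiGraph n) c t → combℚ E c t ≡ ℚ-Linear.comb E c t
combℚ≡comb E c t = trans (sumℚ≡sum (λ a → sumℚ (ℚ-Linear.edgeTerm E c t a)))
                          (ℚ-Linear.sum-cong-≗ λ a → sumℚ≡sum (ℚ-Linear.edgeTerm E c t a))

simplicial⇒forest : ∀ {n} {E : DiGraph n} → Simplicial E → IsForest E
simplicial⇒forest {E = E} simplicial cycle =
  let c , relation , a , b , Eab , c≢0 = ℚ-Linear.cycle-relation (λ ()) cycle
  in c≢0 (simplicial c (λ t → trans (combℚ≡comb E c t) (relation t)) a b Eab)

nonSingular⇒forest : ∀ {n} {E : DiGraph n} → NonSingular E → IsForest E
nonSingular⇒forest {E = E} (k , u , _ , independent , _) cycle =
  let c , relation , a , b , Eab , c≢0 = ℤ-Linear.cycle-relation (λ ()) cycle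
  in c≢0 (proj₁ (independent c (λ _ → ℤ.0ℤ) (relation′ c relation)) a b Eab)
  where
  relation′ : ∀ c → (∀ t → ℤ-Linear.comb E c t ≡ ℤ.0ℤ) → ∀ t → combℤ E c t ℤ.+ sumℤ (λ j → ℤ.0ℤ ℤ.* u j t) ≡ ℤ.0ℤ
  relation′ c relation t = cong₂ ℤ._+_ (trans (combℤ≡comb E c t) (relation t))
    (trans (sumℤ≡sum (λ j → ℤ.0ℤ ℤ.* u j t)) (ℤ-Linear.sum-zero λ j → ℤ.*-zeroˡ (u j t)))

forest⇒simplicial : ∀ {n} {E : DiGraph n} → IsForest E → Simplicial E
forest⇒simplicial {E = E} forest c relation =
  ℚ-Linear.Rooted.rooted-independent (forest⇒rooting {E = E} forest) c (λ _ → 0ℚ)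
  (λ t → trans (ℚ.+-identityʳ _) (trans (sym (combℚ≡comb E c t)) (relation t))) (λ _ → refl)

forest⇒nonSingular : ∀ {n} {E : DiGraph n} → IsForest E → NonSingular E
forest⇒nonSingular {zero} _ =
  0 , (λ ()) , (λ ()) , (λ _ _ _ → (λ ()) , (λ ())) , λ _ _ → (λ _ _ → ℤ.0ℤ) , (λ ()) , λ ()
forest⇒nonSingular {suc n} {E} forest = k , u , u∈H , independent , spanning
  where
  ρ : Rooting E
  ρ = forest⇒rooting forest
  open Rooting ρ using (height)
  open ℤ-Linear.Rooted ρ
  r : Fin (suc n)
  r = argmax height zero (allFin (suc n))
  r-top : ∀ x → height x ≤ height r
  r-top x = All.lookup (f[xs]≤f[argmax] {f = height} zero (allFin (suc n))) (∈-allFin x)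
  roots : Enumeration λ x → ¬ HasParent x × x ≢ r
  roots = enumerate λ x → ¬? (hasParent? x) ×-dec ¬? (x ≟ r)
  open Enumeration roots renaming (size to k; element to root)
  open Completion r r-top roots
  u : Fin k → Fin (suc n) → ℤ
  u j = edgeVecℤ r (root j)
  u∈H : ∀ j → InH (u j)
  u∈H j = trans (sumℤ≡sum (u j)) (ℤ-Linear.sum-edgeVec r (root j))
  bridge : ∀ c d t → combℤ E c t ℤ.+ sumℤ (λ j → d j ℤ.* u j t) ≡ ℤ-Linear.comb E c t ℤ.+ extraComb d t
  bridge c d t = cong₂ ℤ._+_ (combℤ≡comb E c t) (sumℤ≡sum (λ j → d j ℤ.* u j t))
  independent : ∀ c d → (∀ t → combℤ E c t ℤ.+ sumℤ (λ j → d j ℤ.* u j t) ≡ ℤ.0ℤ) →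
    (∀ a b → E a b ≡ true → c a b ≡ ℤ.0ℤ) × (∀ j → d j ≡ ℤ.0ℤ)
  independent c d relation = completion-independent c d λ t → trans (sym (bridge c d t)) (relation t)
  spanning : ∀ y → InH y → Σ (Fin (suc n) → Fin (suc n) → ℤ) λ c → Σ (Fin k → ℤ) λ d →
    ∀ t → y t ≡ combℤ E c t ℤ.+ sumℤ (λ j → d j ℤ.* u j t)
  spanning y y∈H =
    let c , d , represent = completion-spanning y (trans (sym (sumℤ≡sum y)) y∈H)
    in c , d , λ t → trans (represent t) (sym (bridge c d t))

lemma6p6 : ((n : ℕ) (Γ : DiGraph n) → EdgeVectorsAre Γ →
               (Simplicial Γ ⇔ IsForest Γ) × (IsForest Γ ⇔ NonSingular Γ))
           × ((n : ℕ) (w : Permutation′ n) → Simplicial (Ew w) ⇔ NonSingular (Ew w))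
lemma6p6 = (λ _ _ _ → mk⇔ simplicial⇒forest forest⇒simplicial , mk⇔ forest⇒nonSingular nonSingular⇒forest)
         , λ _ _ → mk⇔ (forest⇒nonSingular ∘ simplicial⇒forest) (forest⇒simplicial ∘ nonSingular⇒forest)
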